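{- If there exists a permutation branching program of width $w$ and length $\ell$ that computes the function $\mathrm{AND}_k\colon\{0,1\}^k\to\{0,1\}$, then there exists a versatile $k$-party function on $O(\ell w\log w)$ input bits.
   Context: A permutation branching program (PBP) of width $w$ and length $\ell$ is a sequence of instructions $(i_l,\pi_l,\tau_l)$, $l\in[\ell]$, with $i_l\in[k]$ and $\pi_l,\tau_l$ permutations of $[w]$; on input $y\in\{0,1\}^k$ instruction $l$ evaluates to $\pi_l$ if $y_{i_l}=0$ and to $\tau_l$ otherwise, and the program evaluates to the composition of these permutations. It computes $f$ if for some permutation $\gamma\ne e$ it evaluates to the identity $e$ on every $0$-input and to $\gamma$ on every $1$-input. A $k$-party function is $f\colon\mathcal{X}_1\times\cdots\times\mathcal{X}_k\to\{0,1\}$ with player $i$ holding the $i$-th argument; $f_1\le f_2$ means there are one-to-one maps $\pi_i$ on the $i$-th argument sets with $f_1(x_1,\dots,x_k)=f_2(\pi_1(x_1),\dots,\pi_k(x_k))$. $g$ is flippable if $\neg g\le g$; random-self-reducible if there are maps $\pi_i(x_i,r)$ and a shared random variable $\bm r$ such that for each $z$ and each $z$-input $x$ of $g$, $(\pi_1(x_1,\bm r),\dots,\pi_k(x_k,\bm r))$ is uniform over the $z$-inputs of $g$; versatile if $\mathrm{AND}_k\le g$ (player $i$ holding bit $i$), $g$ is flippable and random-self-reducible. -}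

module Defs where

open import Data.Nat using (ℕ; zero; suc; _+_)
open import Data.Bool using (Bool; true; false; _∧_; not)
open import Data.Fin using (Fin; zero; suc)
open import Data.Fin.Properties using (_≟_; all?)
open import Data.Fin.Permutation using (Permutation′; _⟨$⟩ʳ_; _∘ₚ_; id)
import Data.Vec
open import Data.Vec using (Vec; []; _∷_; count; allFin; tabulate)
open import Data.Product using (Σ; ∃; ∃-syntax; _×_; _,_)
open import Relation.Nullary using (¬_)
open import Relation.Binary.PropositionalEquality using (_≡_)
open import Function.Definitions using (Injective)
open import Function using (_∘_)

Perm : ℕ → Set
Perm = Permutation′

_≈ₚ_ : ∀ {w} → Perm w → Perm w → Set
σ ≈ₚ τ = ∀ j → σ ⟨$⟩ʳ j ≡ τ ⟨$⟩ʳ j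

PBP : (k w ℓ : ℕ) → Set
PBP k w ℓ = Vec (Fin k × Perm w × Perm w) ℓ

instr : ∀ {k w} → (Fin k → Bool) → Fin k × Perm w × Perm w → Perm w
instr y (i , π , τ) with y i
... | false = π
... | true  = τ

evalPBP : ∀ {k w ℓ} → PBP k w ℓ → (Fin k → Bool) → Perm w
evalPBP [] y = id
evalPBP (ins ∷ P) y = instr y ins ∘ₚ evalPBP P y

Computes : ∀ {k w ℓ} → PBP k w ℓ → ((Fin k → Bool) → Bool) → Set
Computes {k} {w} P f = Σ (Perm w) λ γ → ¬ (γ ≈ₚ id) ×
  (∀ (y : Fin k → Bool) → (f y ≡ false → evalPBP P y ≈ₚ id) × (f y ≡ true → evalPBP P y ≈ₚ γ))

AND : (k : ℕ) → (Fin k → Bool) → Bool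
AND zero    x = true
AND (suc k) x = x zero ∧ AND k (x ∘ suc)

Input : (k : ℕ) → (Fin k → ℕ) → Set
Input k s = (i : Fin k) → Fin (s i)

KParty : (k : ℕ) → (Fin k → ℕ) → Set
KParty k s = Input k s → Bool

ANDReduces : ∀ {k s} → KParty k s → Set
ANDReduces {k} {s} g = Σ ((i : Fin k) → Bool → Fin (s i)) λ ρ →
  (∀ i → Injective _≡_ _≡_ (ρ i)) × (∀ (x : Fin k → Bool) → AND k x ≡ g (λ i → ρ i (x i)))

Flippable : ∀ {k s} → KParty k s → Set
Flippable {k} {s} g = Σ ((i : Fin k) → Fin (s i) → Fin (s i)) λ τ →
  (∀ i → Injective _≡_ _≡_ (τ i)) × (∀ (x : Input k s) → not (g x) ≡ g (λ i → τ i (x i)))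

hits : ∀ {k s m} → ((i : Fin k) → Fin (s i) → Fin m → Fin (s i)) → Input k s → Input k s → ℕ
hits {m = m} π x y = count (λ r → all? (λ i → π i (x i) r ≟ y i)) (allFin m)

-- random self-reducible, with the shared randomness r uniform on Fin (suc m):
-- for every z-input x, the image is always a z-input and every z-input y
-- is hit with the same probability (i.e. the image is uniform over z-inputs).
RandomSelfReducible : ∀ {k s} → KParty k s → Set
RandomSelfReducible {k} {s} g = ∃[ m ] Σ ((i : Fin k) → Fin (s i) → Fin (suc m) → Fin (s i)) λ π →
  ∀ (z : Bool) (x : Input k s) → g x ≡ z →
    (∀ (r : Fin (suc m)) → g (λ i → π i (x i) r) ≡ z) ×
    (∀ (y y′ : Input k s) → g y ≡ z → g y′ ≡ z → hits π x y ≡ hits π x y′)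

Versatile : ∀ {k s} → KParty k s → Set
Versatile g = ANDReduces g × Flippable g × RandomSelfReducible g

open import Data.Nat.Logarithm using (⌈log₂_⌉)

inputBits : (k : ℕ) → (Fin k → ℕ) → ℕ
inputBits k s = Data.Vec.sum (tabulate (λ i → ⌈log₂ s i ⌉))

module Submission where

-- Double the points to W = w + w (a left and a right copy of
-- [w]).  Position l of the program is owned by the player holding its
-- variable, who holds a letter aₗ ∈ Sym W there; player 0 also holds a start
-- point u and a final letter c, and g = side of c a_ℓ ⋯ a₁ u.
--   AND_k ≤ g:  aₗ = π or τ acting on both copies, u = the left copy of a
--     point j moved by γ, c = the transposition of the two copies of j.
--   Flippable:  player 0 replaces c by S c, S swapping the copies.
--   Random self-reducible:  shift by telescoping letters, u ↦ r₀ u,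
--     aₗ ↦ rₗ aₗ rₗ₋₁⁻¹, c ↦ E(κ) c r_ℓ⁻¹ with E(κ) side preserving; these
--     shifts form a group acting freely and transitively on the
--     configurations with a given side, so images are uniform.

open import Defs
open import Data.Nat using (ℕ; zero; suc; _*_; _≤_)
open import Data.Nat.Logarithm using (⌈log₂_⌉)
open import Data.Fin using (Fin)
open import Data.Vec using ([]; _∷_)
open import Data.Product using (Σ; ∃; ∃-syntax; _×_; _,_; proj₁; proj₂)
open import Data.Empty using (⊥-elim)

module Pairs where

  open import Data.Nat using (_*_)
  open import Data.Fin using (Fin; combine; remQuot)
  open import Data.Fin.Properties using (combine-remQuot)
  open import Data.Product using (uncurry)
  open import Relation.Binary.PropositionalEquality

  remQuot-injective : ∀ {a} b {z z′ : Fin (a * b)} → remQuot {a} b z ≡ remQuot b z′ → z ≡ z′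
  remQuot-injective {a} b {z} {z′} eq = begin
    z                                   ≡⟨ combine-remQuot {a} b z ⟨
    uncurry combine (remQuot {a} b z)   ≡⟨ cong (uncurry (combine {a} {b})) eq ⟩
    uncurry combine (remQuot {a} b z′)  ≡⟨ combine-remQuot {a} b z′ ⟩
    z′                                  ∎
    where open ≡-Reasoning

module SymCode where
  -- The symmetric group on n points, realised on the finite set Fin (n !) of
  -- canonical codes: a permutation σ is coded by its image of 0 followed by the
  -- code of the permutation it induces on the remaining n - 1 points.  Working
  -- with codes gives a carrier with propositional (and decidable) equality.

  open import Data.Nat using (ℕ; zero; suc; _!)
  open import Data.Fin using (Fin; zero; suc; punchIn; combine; remQuot)
  open import Data.Fin.Properties using (punchIn-injective; remQuot-combine; combine-remQuot)
  open import Data.Fin.Permutation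
    using (_⟨$⟩ʳ_; _∘ₚ_; id; flip; remove; insert; insert-punchIn; remove-insert; insert-remove; punchIn-permute; inverseˡ; inverseʳ)
  open import Data.Product using (proj₁; proj₂)
  open import Relation.Binary.PropositionalEquality
  open import Defs using (Perm; _≈ₚ_)

  encode : ∀ {n} → Perm n → Fin (n !)
  encode {zero}  σ = zero
  encode {suc n} σ = combine (σ ⟨$⟩ʳ zero) (encode (remove zero σ))

  -- Decoding inserts the image of 0 into the decoded rest (n is explicit,
  -- as it cannot be recovered from n !).
  decode : ∀ n → Fin (n !) → Perm n
  decode zero    c = id
  decode (suc n) c = insert zero (proj₁ (remQuot {suc n} (n !) c)) (decode n (proj₂ (remQuot {suc n} (n !) c)))

  remove-cong : ∀ {n} (σ τ : Perm (suc n)) → σ ≈ₚ τ → remove zero σ ≈ₚ remove zero τ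
  remove-cong σ τ σ≈τ j = punchIn-injective (σ ⟨$⟩ʳ zero) _ _ (begin
    punchIn (σ ⟨$⟩ʳ zero) (remove zero σ ⟨$⟩ʳ j)  ≡⟨ punchIn-permute σ zero j ⟨
    σ ⟨$⟩ʳ suc j                                 ≡⟨ σ≈τ (suc j) ⟩
    τ ⟨$⟩ʳ suc j                                 ≡⟨ punchIn-permute τ zero j ⟩
    punchIn (τ ⟨$⟩ʳ zero) (remove zero τ ⟨$⟩ʳ j)  ≡⟨ cong (λ z → punchIn z _) (σ≈τ zero) ⟨
    punchIn (σ ⟨$⟩ʳ zero) (remove zero τ ⟨$⟩ʳ j)  ∎)
    where open ≡-Reasoning

  insert-cong : ∀ {n} (i : Fin (suc n)) (π π′ : Perm n) → π ≈ₚ π′ → insert zero i π ≈ₚ insert zero i π′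
  insert-cong i π π′ π≈π′ zero    = refl
  insert-cong i π π′ π≈π′ (suc k) = begin
    insert zero i π ⟨$⟩ʳ suc k   ≡⟨ insert-punchIn zero i π k ⟩
    punchIn i (π ⟨$⟩ʳ k)         ≡⟨ cong (punchIn i) (π≈π′ k) ⟩
    punchIn i (π′ ⟨$⟩ʳ k)        ≡⟨ insert-punchIn zero i π′ k ⟨
    insert zero i π′ ⟨$⟩ʳ suc k  ∎
    where open ≡-Reasoning

  encode-cong : ∀ {n} (σ τ : Perm n) → σ ≈ₚ τ → encode σ ≡ encode τ
  encode-cong {zero}  σ τ σ≈τ = refl
  encode-cong {suc n} σ τ σ≈τ = cong₂ combine (σ≈τ zero) (encode-cong _ _ (remove-cong σ τ σ≈τ))

  decode-encode : ∀ {n} (σ : Perm n) → decode n (encode σ) ≈ₚ σ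
  decode-encode {zero}  σ ()
  decode-encode {suc n} σ j = begin
    decode (suc n) (encode σ) ⟨$⟩ʳ j
      ≡⟨ cong (λ p → insert zero (proj₁ p) (decode n (proj₂ p)) ⟨$⟩ʳ j) (remQuot-combine (σ ⟨$⟩ʳ zero) _) ⟩
    insert zero (σ ⟨$⟩ʳ zero) (decode n (encode (remove zero σ))) ⟨$⟩ʳ j
      ≡⟨ insert-cong (σ ⟨$⟩ʳ zero) _ _ (decode-encode (remove zero σ)) j ⟩
    insert zero (σ ⟨$⟩ʳ zero) (remove zero σ) ⟨$⟩ʳ j
      ≡⟨ insert-remove zero σ j ⟩
    σ ⟨$⟩ʳ j ∎
    where open ≡-Reasoning

  encode-decode : ∀ n (c : Fin (n !)) → encode (decode n c) ≡ c
  encode-decode zero    zero = refl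
  encode-decode (suc n) c = begin
    combine q (encode (remove zero (insert zero q (decode n r))))
      ≡⟨ cong (combine q) (encode-cong _ _ (remove-insert zero q (decode n r))) ⟩
    combine q (encode (decode n r))
      ≡⟨ cong (combine q) (encode-decode n r) ⟩
    combine q r
      ≡⟨ combine-remQuot {suc n} (n !) c ⟩
    c ∎
    where
    open ≡-Reasoning
    q = proj₁ (remQuot {suc n} (n !) c)
    r = proj₂ (remQuot {suc n} (n !) c)

  -- The group of codes.  Equalities between group words are proved by
  -- comparing their actions on points (code-ext).
  module Sym (n : ℕ) where

    Code : Set
    Code = Fin (n !)

    app : Code → Fin n → Fin n
    app a x = decode n a ⟨$⟩ʳ x

    infixr 7 _·_
    infix  8 _⁻¹

    -- a · b acts as a after b.
    _·_ : Code → Code → Code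
    a · b = encode (decode n b ∘ₚ decode n a)

    _⁻¹ : Code → Code
    a ⁻¹ = encode (flip (decode n a))

    one : Code
    one = encode {n} id

    code-ext : ∀ {a b} → (∀ x → app a x ≡ app b x) → a ≡ b
    code-ext {a} {b} a≈b = begin
      a                    ≡⟨ encode-decode n a ⟨
      encode (decode n a)  ≡⟨ encode-cong (decode n a) (decode n b) a≈b ⟩
      encode (decode n b)  ≡⟨ encode-decode n b ⟩
      b                    ∎
      where open ≡-Reasoning

    app-encode : ∀ (σ : Perm n) x → app (encode σ) x ≡ σ ⟨$⟩ʳ x
    app-encode σ = decode-encode σ

    app-· : ∀ a b x → app (a · b) x ≡ app a (app b x)
    app-· a b = app-encode (decode n b ∘ₚ decode n a)

    app-⁻¹ˡ : ∀ a x → app (a ⁻¹) (app a x) ≡ x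
    app-⁻¹ˡ a x = trans (app-encode (flip (decode n a)) _) (inverseˡ (decode n a))

    app-⁻¹ʳ : ∀ a x → app a (app (a ⁻¹) x) ≡ x
    app-⁻¹ʳ a x = trans (cong (app a) (app-encode (flip (decode n a)) x)) (inverseʳ (decode n a))

    app-injective : ∀ a {x y} → app a x ≡ app a y → x ≡ y
    app-injective a {x} {y} eq = begin
      x                     ≡⟨ app-⁻¹ˡ a x ⟨
      app (a ⁻¹) (app a x)  ≡⟨ cong (app (a ⁻¹)) eq ⟩
      app (a ⁻¹) (app a y)  ≡⟨ app-⁻¹ˡ a y ⟩
      y                     ∎
      where open ≡-Reasoning

    app-⁻¹-· : ∀ a b x → app ((a · b) ⁻¹) x ≡ app (b ⁻¹) (app (a ⁻¹) x)
    app-⁻¹-· a b x = app-injective (a · b) (begin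
      app (a · b) (app ((a · b) ⁻¹) x)           ≡⟨ app-⁻¹ʳ (a · b) x ⟩
      x                                          ≡⟨ app-⁻¹ʳ a x ⟨
      app a (app (a ⁻¹) x)                       ≡⟨ cong (app a) (app-⁻¹ʳ b _) ⟨
      app a (app b (app (b ⁻¹) (app (a ⁻¹) x)))  ≡⟨ app-· a b _ ⟨
      app (a · b) (app (b ⁻¹) (app (a ⁻¹) x))    ∎)
      where open ≡-Reasoning

    app-⁻¹-⁻¹ : ∀ a x → app ((a ⁻¹) ⁻¹) x ≡ app a x
    app-⁻¹-⁻¹ a x = app-injective (a ⁻¹) (trans (app-⁻¹ʳ (a ⁻¹) x) (sym (app-⁻¹ˡ a x)))

    cancelˡ : ∀ a b → a · a ⁻¹ · b ≡ b
    cancelˡ a b = code-ext λ x → trans (app-· a _ x) (trans (cong (app a) (app-· (a ⁻¹) b x)) (app-⁻¹ʳ a _))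

    cancelˡ′ : ∀ a b → a ⁻¹ · a · b ≡ b
    cancelˡ′ a b = code-ext λ x → trans (app-· (a ⁻¹) _ x) (trans (cong (app (a ⁻¹)) (app-· a b x)) (app-⁻¹ˡ a _))

    ·-injectiveʳ : ∀ a {b c} → a · b ≡ a · c → b ≡ c
    ·-injectiveʳ a {b} {c} eq = trans (sym (cancelˡ′ a b)) (trans (cong (a ⁻¹ ·_) eq) (cancelˡ′ a c))

module Telescope (W : ℕ) where
  -- A configuration
  -- (u , a₁ … aₘ , c) is a start point, a word and a final letter; it runs to
  -- the point c aₘ ⋯ a₁ u.  The shift by (r₀ , r₁ … rₘ , r′) replaces u by r₀ u,
  -- aᵢ by rᵢ aᵢ rᵢ₋₁⁻¹ and c by r′ c rₘ⁻¹: the inner factors cancel, so the run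
  -- is moved by r′ alone.  Shifts form a group acting freely on configurations,
  -- and any two configurations whose runs are related by r′ are related by a
  -- shift with outer letter r′.

  open import Data.Nat using (ℕ)
  open import Data.Fin using (Fin)
  open import Data.Vec using (Vec; []; _∷_; zipWith)
  open import Data.Vec.Properties using (∷-injective)
  open import Data.Product using (Σ; _×_; _,_; proj₁; proj₂)
  open import Data.Product.Properties using (,-injectiveˡ; ,-injectiveʳ)
  open import Function using (_∘′_)
  open import Relation.Binary.PropositionalEquality
  open SymCode

  open Sym W

  Config : ℕ → Set
  Config m = Fin W × Vec Code m × Code

  run : ∀ {m} → Config m → Fin W
  run (u , []     , c) = app c u
  run (u , a ∷ as , c) = run (app a u , as , c)

  run-· : ∀ {m} (u : Fin W) (as : Vec Code m) (a c : Code) → run (u , as , a · c) ≡ app a (run (u , as , c))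
  run-· u []        a c = app-· a c u
  run-· u (b ∷ as) a c = run-· (app b u) as a c

  Shift : ℕ → Set
  Shift m = Code × Vec Code m × Code

  lastOf : ∀ {m} → Code → Vec Code m → Code
  lastOf p []       = p
  lastOf p (r ∷ rs) = lastOf r rs

  conjugateWord : ∀ {m} → Code → Vec Code m → Vec Code m → Vec Code m
  conjugateWord p []       []       = []
  conjugateWord p (r ∷ rs) (a ∷ as) = r · a · p ⁻¹ ∷ conjugateWord r rs as

  shift : ∀ {m} → Shift m → Config m → Config m
  shift (r₀ , rs , r′) (u , as , c) = app r₀ u , conjugateWord r₀ rs as , r′ · c · lastOf r₀ rs ⁻¹

  app-conj : ∀ r a p u → app (r · a · p ⁻¹) (app p u) ≡ app r (app a u)
  app-conj r a p u = begin
    app (r · a · p ⁻¹) (app p u)          ≡⟨ app-· r _ _ ⟩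
    app r (app (a · p ⁻¹) (app p u))      ≡⟨ cong (app r) (app-· a _ _) ⟩
    app r (app a (app (p ⁻¹) (app p u)))  ≡⟨ cong (app r ∘′ app a) (app-⁻¹ˡ p u) ⟩
    app r (app a u)                       ∎
    where open ≡-Reasoning

  run-shift : ∀ {m} (r₀ : Code) (rs : Vec Code m) (r′ : Code) (x : Config m) →
              run (shift (r₀ , rs , r′) x) ≡ app r′ (run x)
  run-shift r₀ []       r′ (u , []     , c) = app-conj r′ c r₀ u
  run-shift r₀ (r ∷ rs) r′ (u , a ∷ as , c) =
    trans (cong (λ v → run (v , conjugateWord r rs as , r′ · c · lastOf r rs ⁻¹)) (app-conj r a r₀ u))
          (run-shift r rs r′ (app a u , as , c))

  conj-injective : ∀ r p {a a′} → r · a · p ⁻¹ ≡ r · a′ · p ⁻¹ → a ≡ a′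
  conj-injective r p {a} {a′} eq = code-ext λ z → app-injective r (begin
    app r (app a z)                ≡⟨ app-conj r a p z ⟨
    app (r · a · p ⁻¹) (app p z)   ≡⟨ cong (λ q → app q (app p z)) eq ⟩
    app (r · a′ · p ⁻¹) (app p z)  ≡⟨ app-conj r a′ p z ⟩
    app r (app a′ z)               ∎)
    where open ≡-Reasoning

  conjugateWord-injective : ∀ {m} p (rs as as′ : Vec Code m) → conjugateWord p rs as ≡ conjugateWord p rs as′ → as ≡ as′
  conjugateWord-injective p []       []       []         eq = refl
  conjugateWord-injective p (r ∷ rs) (a ∷ as) (a′ ∷ as′) eq =
    cong₂ _∷_ (conj-injective r p (proj₁ (∷-injective eq))) (conjugateWord-injective r rs as as′ (proj₂ (∷-injective eq)))

  shift-injective : ∀ {m} (s : Shift m) {x x′ : Config m} → shift s x ≡ shift s x′ → x ≡ x′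
  shift-injective (r₀ , rs , r′) {u , as , c} {u′ , as′ , c′} eq =
    cong₂ _,_ (app-injective r₀ (,-injectiveˡ eq))
      (cong₂ _,_ (conjugateWord-injective r₀ rs as as′ (,-injectiveˡ (,-injectiveʳ eq)))
                 (conj-injective r′ (lastOf r₀ rs) (,-injectiveʳ (,-injectiveʳ eq))))

  _⊗_ : ∀ {m} → Shift m → Shift m → Shift m
  (h₀ , hs , h′) ⊗ (r₀ , rs , r′) = h₀ · r₀ , zipWith _·_ hs rs , h′ · r′

  conj-· : ∀ h r a h₀ r₀ → (h · r) · a · (h₀ · r₀) ⁻¹ ≡ h · (r · a · r₀ ⁻¹) · h₀ ⁻¹
  conj-· h r a h₀ r₀ = code-ext λ x → begin
    app ((h · r) · a · (h₀ · r₀) ⁻¹) x                      ≡⟨ app-· (h · r) _ x ⟩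
    app (h · r) (app (a · (h₀ · r₀) ⁻¹) x)                  ≡⟨ app-· h r _ ⟩
    app h (app r (app (a · (h₀ · r₀) ⁻¹) x))                ≡⟨ cong (app h ∘′ app r) (app-· a _ x) ⟩
    app h (app r (app a (app ((h₀ · r₀) ⁻¹) x)))            ≡⟨ cong (app h ∘′ app r ∘′ app a) (app-⁻¹-· h₀ r₀ x) ⟩
    app h (app r (app a (app (r₀ ⁻¹) (app (h₀ ⁻¹) x))))     ≡⟨ cong (app h ∘′ app r) (app-· a _ _) ⟨
    app h (app r (app (a · r₀ ⁻¹) (app (h₀ ⁻¹) x)))         ≡⟨ cong (app h) (app-· r _ _) ⟨
    app h (app (r · a · r₀ ⁻¹) (app (h₀ ⁻¹) x))             ≡⟨ cong (app h) (app-· (r · a · r₀ ⁻¹) _ x) ⟨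
    app h (app ((r · a · r₀ ⁻¹) · h₀ ⁻¹) x)                 ≡⟨ app-· h _ x ⟨
    app (h · (r · a · r₀ ⁻¹) · h₀ ⁻¹) x                     ∎
    where open ≡-Reasoning

  lastOf-zip : ∀ {m} h₀ r₀ (hs rs : Vec Code m) → lastOf (h₀ · r₀) (zipWith _·_ hs rs) ≡ lastOf h₀ hs · lastOf r₀ rs
  lastOf-zip h₀ r₀ []       []       = refl
  lastOf-zip h₀ r₀ (h ∷ hs) (r ∷ rs) = lastOf-zip h r hs rs

  conjugateWord-zip : ∀ {m} h₀ r₀ (hs rs as : Vec Code m) →
    conjugateWord (h₀ · r₀) (zipWith _·_ hs rs) as ≡ conjugateWord h₀ hs (conjugateWord r₀ rs as)
  conjugateWord-zip h₀ r₀ []       []       []       = refl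
  conjugateWord-zip h₀ r₀ (h ∷ hs) (r ∷ rs) (a ∷ as) = cong₂ _∷_ (conj-· h r a h₀ r₀) (conjugateWord-zip h r hs rs as)

  shift-⊗ : ∀ {m} (h r : Shift m) (x : Config m) → shift (h ⊗ r) x ≡ shift h (shift r x)
  shift-⊗ (h₀ , hs , h′) (r₀ , rs , r′) (u , as , c) =
    cong₂ _,_ (app-· h₀ r₀ u) (cong₂ _,_ (conjugateWord-zip h₀ r₀ hs rs as)
      (trans (cong (λ p → (h′ · r′) · c · p ⁻¹) (lastOf-zip h₀ r₀ hs rs)) (conj-· h′ r′ c (lastOf h₀ hs) (lastOf r₀ rs))))

  module Solve (r a a′ : Code) {u u′ : Fin W} (eq : app r (app a u) ≡ app a′ u′) where

    r₀ : Code
    r₀ = a′ ⁻¹ · r · a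

    moves : app r₀ u ≡ u′
    moves = begin
      app (a′ ⁻¹ · r · a) u         ≡⟨ app-· (a′ ⁻¹) _ u ⟩
      app (a′ ⁻¹) (app (r · a) u)   ≡⟨ cong (app (a′ ⁻¹)) (trans (app-· r a u) eq) ⟩
      app (a′ ⁻¹) (app a′ u′)       ≡⟨ app-⁻¹ˡ a′ u′ ⟩
      u′                            ∎
      where open ≡-Reasoning

    conjugates : r · a · r₀ ⁻¹ ≡ a′
    conjugates = code-ext λ x → begin
      app (r · a · r₀ ⁻¹) x
        ≡⟨ app-· r _ x ⟩
      app r (app (a · r₀ ⁻¹) x)
        ≡⟨ cong (app r) (app-· a _ x) ⟩
      app r (app a (app (r₀ ⁻¹) x))
        ≡⟨ cong (app r ∘′ app a) (app-⁻¹-· (a′ ⁻¹) (r · a) x) ⟩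
      app r (app a (app ((r · a) ⁻¹) (app ((a′ ⁻¹) ⁻¹) x)))
        ≡⟨ cong (app r ∘′ app a) (app-⁻¹-· r a _) ⟩
      app r (app a (app (a ⁻¹) (app (r ⁻¹) (app ((a′ ⁻¹) ⁻¹) x))))
        ≡⟨ cong (app r) (app-⁻¹ʳ a _) ⟩
      app r (app (r ⁻¹) (app ((a′ ⁻¹) ⁻¹) x))
        ≡⟨ app-⁻¹ʳ r _ ⟩
      app ((a′ ⁻¹) ⁻¹) x
        ≡⟨ app-⁻¹-⁻¹ a′ x ⟩
      app a′ x ∎
      where open ≡-Reasoning

  shift-transitive : ∀ {m} (x x′ : Config m) (r′ : Code) → app r′ (run x) ≡ run x′ →
                     Σ (Code × Vec Code m) λ (r₀ , rs) → shift (r₀ , rs , r′) x ≡ x′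
  shift-transitive (u , [] , c) (u′ , [] , c′) r′ eq = (r₀ , []) , cong₂ _,_ moves (cong ([] ,_) conjugates)
    where open Solve r′ c c′ eq
  shift-transitive (u , a ∷ as , c) (u′ , a′ ∷ as′ , c′) r′ eq
    with shift-transitive (app a u , as , c) (app a′ u′ , as′ , c′) r′ eq
  ... | (r₁ , rs) , shifted =
    (r₀ , r₁ ∷ rs) , cong₂ _,_ moves (cong₂ (λ b p → b ∷ proj₁ p , proj₂ p) conjugates (,-injectiveʳ shifted))
    where open Solve r₁ a a′ (,-injectiveˡ shifted)

module Doubling (w : ℕ) where
  -- The doubled point set: W = w + w points form a left and a right copy of
  -- Fin w.  Sym w embeds into Sym W by acting on both copies alike (E); these
  -- are exactly the letters that preserve the side of every point, and they act
  -- transitively on each side.  Besides them we need the swap S of the two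
  -- copies and, for each j, the transposition of the two copies of j.

  open import Data.Nat using (ℕ; _+_)
  open import Data.Bool using (Bool; true; false; not)
  open import Data.Fin using (Fin; splitAt; join; _↑ˡ_; _↑ʳ_)
  open import Data.Fin.Properties using (_≟_; splitAt-↑ˡ; splitAt-↑ʳ; splitAt⁻¹-↑ˡ; splitAt⁻¹-↑ʳ; ↑ˡ-injective)
  open import Data.Fin.Permutation using (_⟨$⟩ʳ_; _⟨$⟩ˡ_; permutation; transpose; inverseˡ; inverseʳ)
  import Data.Fin.Permutation.Components as PC
  open import Data.Sum using (inj₁; inj₂; [_,_]′)
  import Data.Sum as Sum
  open import Data.Product using (Σ; _,_)
  open import Function using (_∘′_)
  open import Relation.Nullary.Decidable using (dec-true; dec-false)
  open import Relation.Binary.PropositionalEquality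
  open import Defs using (Perm)
  open SymCode

  W : ℕ
  W = w + w

  module K = Sym w
  open Sym W

  inl inr : Fin w → Fin W
  inl t = t ↑ˡ w
  inr t = w ↑ʳ t

  data Half : Fin W → Set where
    left  : ∀ t → Half (inl t)
    right : ∀ t → Half (inr t)

  half : ∀ x → Half x
  half x with splitAt w x in eq
  ... | inj₁ t = subst Half (splitAt⁻¹-↑ˡ eq) (left t)
  ... | inj₂ t = subst Half (splitAt⁻¹-↑ʳ eq) (right t)

  side : Fin W → Bool
  side x = [ (λ _ → true) , (λ _ → false) ]′ (splitAt w x)

  side-inl : ∀ t → side (inl t) ≡ true
  side-inl t = cong [ (λ _ → true) , (λ _ → false) ]′ (splitAt-↑ˡ w t w)

  side-inr : ∀ t → side (inr t) ≡ false
  side-inr t = cong [ (λ _ → true) , (λ _ → false) ]′ (splitAt-↑ʳ w w t)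

  inl≢inr : ∀ a b → inl a ≢ inr b
  inl≢inr a b eq with trans (sym (side-inl a)) (trans (cong side eq) (side-inr b))
  ... | ()

  both : (Fin w → Fin w) → Fin W → Fin W
  both f x = join w w (Sum.map f f (splitAt w x))

  both-inl : ∀ f t → both f (inl t) ≡ inl (f t)
  both-inl f t = cong (join w w ∘′ Sum.map f f) (splitAt-↑ˡ w t w)

  both-inr : ∀ f t → both f (inr t) ≡ inr (f t)
  both-inr f t = cong (join w w ∘′ Sum.map f f) (splitAt-↑ʳ w w t)

  both-∘ : ∀ f g x → both f (both g x) ≡ both (f ∘′ g) x
  both-∘ f g x with half x
  ... | left t  = trans (cong (both f) (both-inl g t)) (trans (both-inl f (g t)) (sym (both-inl (f ∘′ g) t)))
  ... | right t = trans (cong (both f) (both-inr g t)) (trans (both-inr f (g t)) (sym (both-inr (f ∘′ g) t)))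

  both-id : ∀ f → (∀ t → f t ≡ t) → ∀ x → both f x ≡ x
  both-id f f≗id x with half x
  ... | left t  = trans (both-inl f t) (cong inl (f≗id t))
  ... | right t = trans (both-inr f t) (cong inr (f≗id t))

  both-cong : ∀ {f g} → (∀ t → f t ≡ g t) → ∀ x → both f x ≡ both g x
  both-cong {f} {g} f≗g x with half x
  ... | left t  = trans (both-inl f t) (trans (cong inl (f≗g t)) (sym (both-inl g t)))
  ... | right t = trans (both-inr f t) (trans (cong inr (f≗g t)) (sym (both-inr g t)))

  side-both : ∀ f x → side (both f x) ≡ side x
  side-both f x with half x
  ... | left t  = trans (cong side (both-inl f t)) (trans (side-inl (f t)) (sym (side-inl t)))
  ... | right t = trans (cong side (both-inr f t)) (trans (side-inr (f t)) (sym (side-inr t)))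

  doubled : Perm w → Perm W
  doubled σ = permutation (both (σ ⟨$⟩ʳ_)) (both (σ ⟨$⟩ˡ_))
    (λ x → trans (both-∘ _ _ x) (both-id _ (λ _ → inverseʳ σ) x))
    (λ x → trans (both-∘ _ _ x) (both-id _ (λ _ → inverseˡ σ) x))

  E : K.Code → Code
  E κ = encode (doubled (decode w κ))

  app-E : ∀ κ x → app (E κ) x ≡ both (K.app κ) x
  app-E κ = app-encode (doubled (decode w κ))

  E-inl : ∀ κ t → app (E κ) (inl t) ≡ inl (K.app κ t)
  E-inl κ t = trans (app-E κ (inl t)) (both-inl (K.app κ) t)

  E-inr : ∀ κ t → app (E κ) (inr t) ≡ inr (K.app κ t)
  E-inr κ t = trans (app-E κ (inr t)) (both-inr (K.app κ) t)

  side-E : ∀ κ x → side (app (E κ) x) ≡ side x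
  side-E κ x = trans (cong side (app-E κ x)) (side-both (K.app κ) x)

  E-hom : ∀ κ λ′ → E (κ K.· λ′) ≡ E κ · E λ′
  E-hom κ λ′ = code-ext λ x → begin
    app (E (κ K.· λ′)) x                  ≡⟨ app-E _ x ⟩
    both (K.app (κ K.· λ′)) x             ≡⟨ both-cong (K.app-· κ λ′) x ⟩
    both (K.app κ ∘′ K.app λ′) x          ≡⟨ both-∘ _ _ x ⟨
    both (K.app κ) (both (K.app λ′) x)    ≡⟨ trans (app-E κ _) (cong (both (K.app κ)) (app-E λ′ x)) ⟨
    app (E κ) (app (E λ′) x)              ≡⟨ app-· (E κ) (E λ′) x ⟨
    app (E κ · E λ′) x                    ∎
    where open ≡-Reasoning

  transpose-here : ∀ {n} (i j : Fin n) → PC.transpose i j i ≡ j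
  transpose-here i j rewrite dec-true (i ≟ i) refl = refl

  transpose-elsewhere : ∀ {n} (i j k : Fin n) → k ≢ i → k ≢ j → PC.transpose i j k ≡ k
  transpose-elsewhere i j k k≢i k≢j rewrite dec-false (k ≟ i) k≢i | dec-false (k ≟ j) k≢j = refl

  moves : ∀ a b → K.app (encode (transpose a b)) a ≡ b
  moves a b = trans (K.app-encode (transpose a b) a) (transpose-here a b)

  E-transitive : ∀ x y → side x ≡ side y → Σ K.Code λ κ → app (E κ) x ≡ y
  E-transitive x y eq with half x | half y
  ... | left a  | left b  = encode (transpose a b) , trans (E-inl _ a) (cong inl (moves a b))
  ... | right a | right b = encode (transpose a b) , trans (E-inr _ a) (cong inr (moves a b))
  ... | left a  | right b with trans (sym (side-inl a)) (trans eq (side-inr b))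
  ...   | ()
  E-transitive x y eq | right a | left b with trans (sym (side-inr a)) (trans eq (side-inl b))
  ...   | ()

  swap : Fin W → Fin W
  swap x = join w w (Sum.swap (splitAt w x))

  swap-inl : ∀ t → swap (inl t) ≡ inr t
  swap-inl t = cong (join w w ∘′ Sum.swap) (splitAt-↑ˡ w t w)

  swap-inr : ∀ t → swap (inr t) ≡ inl t
  swap-inr t = cong (join w w ∘′ Sum.swap) (splitAt-↑ʳ w w t)

  swap-involutive : ∀ x → swap (swap x) ≡ x
  swap-involutive x with half x
  ... | left t  = trans (cong swap (swap-inl t)) (swap-inr t)
  ... | right t = trans (cong swap (swap-inr t)) (swap-inl t)

  S : Code
  S = encode (permutation swap swap swap-involutive swap-involutive)

  side-S : ∀ x → side (app S x) ≡ not (side x)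
  side-S x with half x
  ... | left t  = trans (cong side (trans (app-encode _ _) (swap-inl t))) (trans (side-inr t) (cong not (sym (side-inl t))))
  ... | right t = trans (cong side (trans (app-encode _ _) (swap-inr t))) (trans (side-inl t) (cong not (sym (side-inr t))))

  X : Fin w → Code
  X j = encode (transpose (inl j) (inr j))

  side-X-here : ∀ j → side (app (X j) (inl j)) ≡ false
  side-X-here j = trans (cong side (trans (app-encode _ _) (transpose-here (inl j) (inr j)))) (side-inr j)

  side-X-elsewhere : ∀ j t → t ≢ j → side (app (X j) (inl t)) ≡ true
  side-X-elsewhere j t t≢j = trans (cong side (trans (app-encode _ _)
    (transpose-elsewhere (inl j) (inr j) (inl t) (t≢j ∘′ ↑ˡ-injective w t j) (inl≢inr t j)))) (side-inl t)

module Layout (M : ℕ) where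
  -- A list of owners o₁ … oₘ ∈ Fin k
  -- fixes, for each player i, a share space Fin (size os i) that is the product
  -- over the positions l of Fin M if oₗ = i and of a one-point set otherwise.
  -- Reading the shares of all players recovers a word in (Fin M)ᵐ; reading is
  -- injective, players can write their letters independently, and a
  -- position-wise transformation of the word can be carried out by each player
  -- on his own share.

  open import Data.Nat using (ℕ; zero; suc; _*_)
  open import Data.Fin using (Fin; zero; suc; combine; remQuot)
  open import Data.Fin.Properties using (_≟_; remQuot-combine; combine-injective)
  open import Data.Vec using (Vec; []; _∷_; lookup; tabulate; _⊛_)
  open import Data.Vec.Properties using (∷-injective)
  open import Data.Product using (_,_; proj₁; proj₂)
  open import Data.Empty using (⊥-elim)
  open import Function using (_∘_)
  open import Relation.Nullary using (yes; no)
  open import Relation.Binary.PropositionalEquality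
  open import Defs using (Input)
  open Pairs

  slot : ∀ {k} → Fin k → Fin k → ℕ
  slot zero    zero    = M
  slot zero    (suc _) = 1
  slot (suc _) zero    = 1
  slot (suc o) (suc i) = slot o i

  letter : ∀ {k} (o : Fin k) → Fin (slot o o) → Fin M
  letter zero    c = c
  letter (suc o) c = letter o c

  place : ∀ {k} (o i : Fin k) → Fin M → Fin (slot o i)
  place zero    zero    a = a
  place zero    (suc _) a = zero
  place (suc _) zero    a = zero
  place (suc o) (suc i) a = place o i a

  mapSlot : ∀ {k} (o i : Fin k) → (Fin M → Fin M) → Fin (slot o i) → Fin (slot o i)
  mapSlot zero    zero    f c = f c
  mapSlot zero    (suc _) f c = c
  mapSlot (suc _) zero    f c = c
  mapSlot (suc o) (suc i) f c = mapSlot o i f c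

  letter-place : ∀ {k} (o : Fin k) a → letter o (place o o a) ≡ a
  letter-place zero    a = refl
  letter-place (suc o) a = letter-place o a

  place-letter : ∀ {k} (o : Fin k) c → place o o (letter o c) ≡ c
  place-letter zero    c = refl
  place-letter (suc o) c = place-letter o c

  letter-mapSlot : ∀ {k} (o : Fin k) f c → letter o (mapSlot o o f c) ≡ f (letter o c)
  letter-mapSlot zero    f c = refl
  letter-mapSlot (suc o) f c = letter-mapSlot o f c

  slot-trivial : ∀ {k} (o i : Fin k) → o ≢ i → (a b : Fin (slot o i)) → a ≡ b
  slot-trivial zero    zero    o≢i a    b    = ⊥-elim (o≢i refl)
  slot-trivial zero    (suc i) o≢i zero zero = refl
  slot-trivial (suc o) zero    o≢i zero zero = refl
  slot-trivial (suc o) (suc i) o≢i a    b    = slot-trivial o i (o≢i ∘ cong suc) a b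

  letter-injective : ∀ {k} (o : Fin k) {a b} → letter o a ≡ letter o b → a ≡ b
  letter-injective o {a} {b} eq = trans (sym (place-letter o a)) (trans (cong (place o o) eq) (place-letter o b))

  size : ∀ {k m} → Vec (Fin k) m → Fin k → ℕ
  size []       i = 1
  size (o ∷ os) i = slot o i * size os i

  module _ {k m} (o : Fin k) (os : Vec (Fin k) m) (i : Fin k) where

    first : Fin (size (o ∷ os) i) → Fin (slot o i)
    first z = proj₁ (remQuot {slot o i} (size os i) z)

    rest : Fin (size (o ∷ os) i) → Fin (size os i)
    rest z = proj₂ (remQuot {slot o i} (size os i) z)

    first-combine : ∀ (a : Fin (slot o i)) (z : Fin (size os i)) → first (combine a z) ≡ a
    first-combine a z = cong proj₁ (remQuot-combine a z)

    rest-combine : ∀ (a : Fin (slot o i)) (z : Fin (size os i)) → rest (combine a z) ≡ z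
    rest-combine a z = cong proj₂ (remQuot-combine a z)

  read : ∀ {k m} (os : Vec (Fin k) m) → Input k (size os) → Vec (Fin M) m
  read []       x = []
  read (o ∷ os) x = letter o (first o os o (x o)) ∷ read os (λ i → rest o os i (x i))

  read-cong : ∀ {k m} (os : Vec (Fin k) m) {x y : Input k (size os)} → (∀ i → x i ≡ y i) → read os x ≡ read os y
  read-cong []       x≗y = refl
  read-cong (o ∷ os) x≗y = cong₂ _∷_ (cong (letter o ∘ first o os o) (x≗y o)) (read-cong os (λ i → cong (rest o os i) (x≗y i)))

  read-injective : ∀ {k m} (os : Vec (Fin k) m) (x y : Input k (size os)) → read os x ≡ read os y → ∀ i → x i ≡ y i
  read-injective []       x y eq i with x i | y i
  ... | zero | zero = refl
  read-injective (o ∷ os) x y eq i =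
    remQuot-injective (size os i) (cong₂ _,_ (firsts i) (read-injective os _ _ (proj₂ (∷-injective eq)) i))
    where
    firsts : ∀ i → first o os i (x i) ≡ first o os i (y i)
    firsts i with o ≟ i
    ... | yes refl = letter-injective o (proj₁ (∷-injective eq))
    ... | no o≢i   = slot-trivial o i o≢i _ _

  write : ∀ {k m} (os : Vec (Fin k) m) (i : Fin k) → (Fin m → Fin M) → Fin (size os i)
  write []       i ws = zero
  write (o ∷ os) i ws = combine (place o i (ws zero)) (write os i (λ l → ws (suc l)))

  read-write : ∀ {k m} (os : Vec (Fin k) m) (ws : Fin k → Fin m → Fin M) →
               read os (λ i → write os i (ws i)) ≡ tabulate (λ l → ws (lookup os l) l)
  read-write []       ws = refl
  read-write (o ∷ os) ws = cong₂ _∷_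
    (trans (cong (letter o) (first-combine o os o _ _)) (letter-place o _))
    (trans (read-cong os (λ i → rest-combine o os i _ _)) (read-write os (λ i l → ws i (suc l))))

  write-injective : ∀ {k m} (os : Vec (Fin k) m) (i : Fin k) (ws ws′ : Fin m → Fin M) →
                    write os i ws ≡ write os i ws′ → ∀ l → lookup os l ≡ i → ws l ≡ ws′ l
  write-injective (o ∷ os) .o ws ws′ eq zero refl =
    trans (sym (letter-place o _)) (trans (cong (letter o) (proj₁ (combine-injective {m = slot o o} _ _ _ _ eq))) (letter-place o _))
  write-injective (o ∷ os) i  ws ws′ eq (suc l) owner =
    write-injective os i _ _ (proj₂ (combine-injective {m = slot o i} _ _ _ _ eq)) l owner

  transform : ∀ {k m} (os : Vec (Fin k) m) (i : Fin k) → Vec (Fin M → Fin M) m → Fin (size os i) → Fin (size os i)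
  transform []       i []       z = z
  transform (o ∷ os) i (f ∷ fs) z = combine (mapSlot o i f (first o os i z)) (transform os i fs (rest o os i z))

  read-transform : ∀ {k m} (os : Vec (Fin k) m) (fs : Vec (Fin M → Fin M) m) (x : Input k (size os)) →
                   read os (λ i → transform os i fs (x i)) ≡ (fs ⊛ read os x)
  read-transform []       []       x = refl
  read-transform (o ∷ os) (f ∷ fs) x = cong₂ _∷_
    (trans (cong (letter o) (first-combine o os o _ _)) (letter-mapSlot o f _))
    (trans (read-cong os (λ i → rest-combine o os i _ _)) (read-transform os fs _))

module Counting where
  -- Finite sets coded by Fin (suc n), and invariance of counts under bijections.
  -- A random variable uniform on such a set is a uniform code r ∈ Fin (suc n).
  -- If a bijection τ of the set turns the event "the random maps send x to y"
  -- into "they send x to y′", then both events are hit by equally many codes.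

  open import Level using (0ℓ)
  open import Data.Nat using (ℕ; zero; suc; _+_; _*_)
  open import Data.Nat.Properties using (+-0-commutativeMonoid)
  open import Data.Bool using (true; false)
  open import Data.Fin using (Fin; zero; suc; combine; remQuot)
  open import Data.Fin.Properties using (_≟_; all?; remQuot-combine; combine-remQuot)
  open import Data.Fin.Permutation using (Permutation′; _⟨$⟩ʳ_; permutation)
  open import Data.Vec using (Vec; []; _∷_; count; tabulate; allFin)
  open import Data.Product using (_×_; _,_; proj₁; proj₂)
  open import Data.Empty using (⊥-elim)
  open import Function using (_∘_)
  open import Relation.Nullary using (yes; no; does)
  open import Relation.Unary using (Pred; Decidable)
  open import Relation.Binary.PropositionalEquality
  open import Algebra.Properties.CommutativeMonoid.Sum +-0-commutativeMonoid using (sum; sum-permute; sum-cong-≗)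
  open import Defs using (Input; hits)

  indicator : ∀ {A : Set} {P : Pred A 0ℓ} → Decidable P → A → ℕ
  indicator P? a with does (P? a)
  ... | true  = 1
  ... | false = 0

  count-tabulate : ∀ {n} {A : Set} {P : Pred A 0ℓ} (P? : Decidable P) (f : Fin n → A) →
                   count P? (tabulate f) ≡ sum (indicator P? ∘ f)
  count-tabulate {zero}  P? f = refl
  count-tabulate {suc n} P? f with does (P? (f zero))
  ... | true  = cong suc (count-tabulate P? (f ∘ suc))
  ... | false = count-tabulate P? (f ∘ suc)

  indicator-cong : ∀ {A B : Set} {P : Pred A 0ℓ} {Q : Pred B 0ℓ} (P? : Decidable P) (Q? : Decidable Q) a b →
                   (P a → Q b) → (Q b → P a) → indicator P? a ≡ indicator Q? b
  indicator-cong P? Q? a b to from with P? a | Q? b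
  ... | yes p | yes q = refl
  ... | no ¬p | no ¬q = refl
  ... | yes p | no ¬q = ⊥-elim (¬q (to p))
  ... | no ¬p | yes q = ⊥-elim (¬p (from q))

  count-permute : ∀ {n} (σ : Permutation′ n) {P Q : Pred (Fin n) 0ℓ} (P? : Decidable P) (Q? : Decidable Q) →
                  (∀ r → Q (σ ⟨$⟩ʳ r) → P r) → (∀ r → P r → Q (σ ⟨$⟩ʳ r)) →
                  count Q? (allFin n) ≡ count P? (allFin n)
  count-permute {n} σ P? Q? to from = begin
    count Q? (allFin n)                 ≡⟨ count-tabulate Q? (λ r → r) ⟩
    sum (indicator Q?)                  ≡⟨ sum-permute (indicator Q?) σ ⟩
    sum (λ r → indicator Q? (σ ⟨$⟩ʳ r)) ≡⟨ sum-cong-≗ (λ r → indicator-cong Q? P? _ r (to r) (from r)) ⟩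
    sum (indicator P?)                  ≡⟨ count-tabulate P? (λ r → r) ⟨
    count P? (allFin n)                 ∎
    where open ≡-Reasoning

  record Coding (A : Set) : Set where
    field
      bound         : ℕ
      code          : A → Fin (suc bound)
      uncode        : Fin (suc bound) → A
      uncode-code   : ∀ a → uncode (code a) ≡ a
      code-uncode   : ∀ c → code (uncode c) ≡ c

  open Coding

  finCoding : ∀ {N} → Fin N → Coding (Fin N)
  finCoding {suc n} _ = record { bound = n ; code = λ c → c ; uncode = λ c → c ; uncode-code = λ _ → refl ; code-uncode = λ _ → refl }

  isoCoding : ∀ {A B : Set} (f : A → B) (g : B → A) → (∀ a → g (f a) ≡ a) → (∀ b → f (g b) ≡ b) → Coding A → Coding B
  isoCoding f g gf fg C = record
    { bound       = bound C
    ; code        = code C ∘ g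
    ; uncode      = f ∘ uncode C
    ; uncode-code = λ b → trans (cong f (uncode-code C (g b))) (fg b)
    ; code-uncode = λ c → trans (cong (code C) (gf (uncode C c))) (code-uncode C c)
    }

  -- Pairs are coded by combining codes (suc a * suc b reduces to suc (b + a * suc b)).
  ×-coding : ∀ {A B : Set} → Coding A → Coding B → Coding (A × B)
  ×-coding {A} {B} CA CB = record
    { bound       = bound CB + bound CA * suc (bound CB)
    ; code        = λ (a , b) → combine (code CA a) (code CB b)
    ; uncode      = λ c → uncode CA (proj₁ (split c)) , uncode CB (proj₂ (split c))
    ; uncode-code = λ (a , b) → cong₂ _,_
        (trans (cong (uncode CA ∘ proj₁) (remQuot-combine (code CA a) (code CB b))) (uncode-code CA a))
        (trans (cong (uncode CB ∘ proj₂) (remQuot-combine (code CA a) (code CB b))) (uncode-code CB b))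
    ; code-uncode = λ c → trans (cong₂ combine (code-uncode CA _) (code-uncode CB _)) (combine-remQuot (suc (bound CB)) c)
    }
    where
    split : Fin (suc (bound CA) * suc (bound CB)) → Fin (suc (bound CA)) × Fin (suc (bound CB))
    split = remQuot (suc (bound CB))

  vecCoding : ∀ {A : Set} → Coding A → ∀ m → Coding (Vec A m)
  vecCoding C zero    = record
    { bound = 0 ; code = λ _ → zero ; uncode = λ _ → [] ; uncode-code = λ { [] → refl } ; code-uncode = λ { zero → refl } }
  vecCoding C (suc m) = isoCoding (λ (x , xs) → x ∷ xs) (λ { (x ∷ xs) → x , xs }) (λ _ → refl) (λ { (x ∷ xs) → refl })
    (×-coding C (vecCoding C m))

  module _ {k} {s : Fin k → ℕ} {R : Set} (C : Coding R) (π : (i : Fin k) → Fin (s i) → R → Fin (s i)) where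

    coded : (i : Fin k) → Fin (s i) → Fin (suc (bound C)) → Fin (s i)
    coded i z c = π i z (uncode C c)

    hits-transfer : (τ τ⁻ : R → R) → (∀ r → τ (τ⁻ r) ≡ r) → (∀ r → τ⁻ (τ r) ≡ r) → ∀ (x y y′ : Input k s) →
                    (∀ r → (∀ i → π i (x i) (τ r) ≡ y′ i) → ∀ i → π i (x i) r ≡ y i) →
                    (∀ r → (∀ i → π i (x i) r ≡ y i) → ∀ i → π i (x i) (τ r) ≡ y′ i) →
                    hits coded x y ≡ hits coded x y′
    hits-transfer τ τ⁻ ττ⁻ τ⁻τ x y y′ to from = sym (count-permute σ
      (λ c → all? (λ i → coded i (x i) c ≟ y i)) (λ c → all? (λ i → coded i (x i) c ≟ y′ i))
      (λ c hit → to (uncode C c) (subst (λ r → ∀ i → π i (x i) r ≡ y′ i) (uncode-τ c) hit))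
      (λ c hit → subst (λ r → ∀ i → π i (x i) r ≡ y′ i) (sym (uncode-τ c)) (from (uncode C c) hit)))
      where
      along : (R → R) → Fin (suc (bound C)) → Fin (suc (bound C))
      along f = code C ∘ f ∘ uncode C
      σ : Permutation′ (suc (bound C))
      σ = permutation (along τ) (along τ⁻)
        (λ c → trans (cong (code C ∘ τ) (uncode-code C _)) (trans (cong (code C) (ττ⁻ _)) (code-uncode C c)))
        (λ c → trans (cong (code C ∘ τ⁻) (uncode-code C _)) (trans (cong (code C) (τ⁻τ _)) (code-uncode C c)))
      uncode-τ : ∀ c → uncode C (σ ⟨$⟩ʳ c) ≡ τ (uncode C c)
      uncode-τ c = uncode-code C _

module Sensitivity where
  -- What a PBP computing AND_k must look like: its value γ on the all-ones
  -- input moves some point j (so w ≥ 2), it has at least one instruction, and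
  -- every variable i is read by some instruction whose two permutations differ
  -- (otherwise the program could not tell the all-ones input from the input
  -- that is 0 only at i).

  open import Data.Nat using (zero; suc; _≤_; s≤s; z≤n)
  open import Data.Bool using (Bool; true; false)
  open import Data.Bool.Properties using (∧-zeroʳ)
  open import Data.Fin using (Fin; zero; suc)
  open import Data.Fin.Properties using (_≟_; all?; ¬∀⟶∃¬)
  open import Data.Fin.Permutation using (_⟨$⟩ʳ_; id)
  open import Data.Vec using ([]; _∷_; lookup)
  open import Data.Product using (Σ; _×_; _,_; proj₁; proj₂)
  open import Data.Empty using (⊥-elim)
  open import Data.Sum using (_⊎_; inj₁; inj₂)
  open import Relation.Nullary using (Dec; yes; no; ¬_)
  open import Relation.Binary.PropositionalEquality
  open import Defs using (PBP; Perm; instr; evalPBP; _≈ₚ_; AND; Computes)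

  AND-ones : ∀ k → AND k (λ _ → true) ≡ true
  AND-ones zero    = refl
  AND-ones (suc k) = AND-ones k

  AND-zero : ∀ k (y : Fin k → Bool) i → y i ≡ false → AND k y ≡ false
  AND-zero (suc k) y zero    yi≡0 rewrite yi≡0 = refl
  AND-zero (suc k) y (suc i) yi≡0 rewrite AND-zero k (λ t → y (suc t)) i yi≡0 = ∧-zeroʳ (y zero)

  onesExcept : ∀ {k} → Fin k → Fin k → Bool
  onesExcept i i′ with i′ ≟ i
  ... | yes _ = false
  ... | no  _ = true

  onesExcept-here : ∀ {k} (i : Fin k) → onesExcept i i ≡ false
  onesExcept-here i with i ≟ i
  ... | yes _   = refl
  ... | no  i≢i = ⊥-elim (i≢i refl)

  onesExcept-elsewhere : ∀ {k} (i i′ : Fin k) → i′ ≢ i → onesExcept i i′ ≡ true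
  onesExcept-elsewhere i i′ i′≢i with i′ ≟ i
  ... | yes i′≡i = ⊥-elim (i′≢i i′≡i)
  ... | no  _    = refl

  Harmless : ∀ {k w} → Fin k × Perm w × Perm w → Set
  Harmless (o , π , τ) = π ≈ₚ τ

  instr-agree : ∀ {k w} (ins : Fin k × Perm w × Perm w) (y y′ : Fin k → Bool) →
                (Harmless ins ⊎ y (proj₁ ins) ≡ y′ (proj₁ ins)) → instr y ins ≈ₚ instr y′ ins
  instr-agree (o , π , τ) y y′ reason with y o | y′ o | reason
  ... | false | false | _ = λ _ → refl
  ... | true  | true  | _ = λ _ → refl
  ... | false | true  | inj₁ π≈τ = π≈τ
  ... | true  | false | inj₁ π≈τ = λ t → sym (π≈τ t)
  ... | false | true  | inj₂ ()
  ... | true  | false | inj₂ ()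

  evalPBP-ignores : ∀ {k w ℓ} (P : PBP k w ℓ) (i : Fin k) → (∀ l → proj₁ (lookup P l) ≡ i → Harmless (lookup P l)) →
                    ∀ (y y′ : Fin k → Bool) → (∀ i′ → i′ ≢ i → y i′ ≡ y′ i′) → evalPBP P y ≈ₚ evalPBP P y′
  evalPBP-ignores []        i harmless y y′ agree t = refl
  evalPBP-ignores (ins ∷ P) i harmless y y′ agree t =
    trans (cong (evalPBP P y ⟨$⟩ʳ_) (instr-agree ins y y′ reason t))
          (evalPBP-ignores P i (λ l → harmless (suc l)) y y′ agree _)
    where
    reason : Harmless ins ⊎ y (proj₁ ins) ≡ y′ (proj₁ ins)
    reason with proj₁ ins ≟ i
    ... | yes reads-i = inj₁ (harmless zero reads-i)
    ... | no  other   = inj₂ (agree (proj₁ ins) other)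

  module Requirements {k w ℓ} (P : PBP k w ℓ) (computes : Computes P (AND k)) where

    γ : Perm w
    γ = proj₁ computes

    on-ones : evalPBP P (λ _ → true) ≈ₚ γ
    on-ones = proj₂ (proj₂ (proj₂ computes) (λ _ → true)) (AND-ones k)

    moved : Σ (Fin w) λ j → γ ⟨$⟩ʳ j ≢ j
    moved = ¬∀⟶∃¬ w (λ t → γ ⟨$⟩ʳ t ≡ t) (λ t → γ ⟨$⟩ʳ t ≟ t) (proj₁ (proj₂ computes))

    Ignores : Fin k → Fin ℓ → Set
    Ignores i l = proj₁ (lookup P l) ≡ i → Harmless (lookup P l)

    ignores? : ∀ i l → Dec (Ignores i l)
    ignores? i l with proj₁ (lookup P l) ≟ i | all? (λ t → proj₁ (proj₂ (lookup P l)) ⟨$⟩ʳ t ≟ proj₂ (proj₂ (lookup P l)) ⟨$⟩ʳ t)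
    ... | _           | yes harmless = yes (λ _ → harmless)
    ... | no  other   | no  _        = yes (λ reads-i → ⊥-elim (other reads-i))
    ... | yes reads-i | no  harmful  = no (λ ignores → harmful (ignores reads-i))

    not-all-ignore : ∀ i → ¬ (∀ l → Ignores i l)
    not-all-ignore i ignores = proj₁ (proj₂ computes) (λ t → begin
      γ ⟨$⟩ʳ t                         ≡⟨ on-ones t ⟨
      evalPBP P (λ _ → true) ⟨$⟩ʳ t    ≡⟨ evalPBP-ignores P i ignores _ _ (λ i′ i′≢i → sym (onesExcept-elsewhere i i′ i′≢i)) t ⟩
      evalPBP P (onesExcept i) ⟨$⟩ʳ t  ≡⟨ proj₁ (proj₂ (proj₂ computes) (onesExcept i)) (AND-zero k _ i (onesExcept-here i)) t ⟩
      id ⟨$⟩ʳ t                        ∎)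
      where open ≡-Reasoning

    sensitive : ∀ i → Σ (Fin ℓ) λ l → proj₁ (lookup P l) ≡ i × ¬ Harmless (lookup P l)
    sensitive i with ¬∀⟶∃¬ ℓ (Ignores i) (ignores? i) (not-all-ignore i)
    ... | l , ¬ignores with proj₁ (lookup P l) ≟ i
    ...   | yes reads-i = l , reads-i , (λ harmless → ¬ignores (λ _ → harmless))
    ...   | no  other   = ⊥-elim (¬ignores (λ reads-i → ⊥-elim (other reads-i)))

  empty-program : ∀ {k w} → ¬ Computes {k} {w} [] (AND k)
  empty-program {k} (γ , γ≉id , computes) = γ≉id (λ t → sym (proj₂ (computes (λ _ → true)) (AND-ones k) t))

  two-points : ∀ {w} (a b : Fin w) → a ≢ b → 2 ≤ w
  two-points {suc zero}    zero zero a≢b = ⊥-elim (a≢b refl)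
  two-points {suc (suc w)} a    b    a≢b = s≤s (s≤s z≤n)

  program-nonempty : ∀ {k w ℓ} (P : PBP k w ℓ) → Computes P (AND k) → 1 ≤ ℓ
  program-nonempty []      computes = ⊥-elim (empty-program computes)
  program-nonempty (_ ∷ _) _        = s≤s z≤n

module TheFunction {k′ w ℓ : ℕ} (P : PBP (suc k′) w ℓ) where
  -- Every player holds a share (Layout, with the owners of P's instructions and
  -- letters in Sym W); player 0 holds in addition the start point u ∈ Fin W and
  -- the final letter c ∈ Sym W.

  open import Data.Nat using (ℕ; suc; _*_; _!)
  open import Data.Fin using (Fin; zero; suc; combine; remQuot)
  open import Data.Fin.Properties using (remQuot-combine; combine-injective)
  open import Data.Vec using (Vec; map)
  open import Data.Product using (_×_; _,_; proj₁; proj₂)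
  open import Function using (_∘_)
  open import Function.Definitions using (Injective)
  open import Relation.Binary.PropositionalEquality
  open import Data.Product.Properties using (,-injectiveˡ; ,-injectiveʳ)
  open import Defs using (PBP; Input; KParty)
  open Pairs
  open SymCode

  k : ℕ
  k = suc k′

  open Doubling w public
  open Sym W public
  open Telescope W public
  open Layout (W !) public

  owners : Vec (Fin k) ℓ
  owners = map proj₁ P

  extra : Fin k → ℕ
  extra zero    = W * W !
  extra (suc _) = 1

  sizes : Fin k → ℕ
  sizes i = extra i * size owners i

  extraOf : ∀ i → Fin (sizes i) → Fin (extra i)
  extraOf i z = proj₁ (remQuot {extra i} (size owners i) z)

  shareOf : ∀ i → Fin (sizes i) → Fin (size owners i)
  shareOf i z = proj₂ (remQuot {extra i} (size owners i) z)

  outer : Fin (extra zero) → Fin W × Code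
  outer e = remQuot (W !) e

  config : Input k sizes → Config ℓ
  config x = proj₁ (outer (extraOf zero (x zero))) , read owners (λ i → shareOf i (x i)) , proj₂ (outer (extraOf zero (x zero)))

  g : KParty k sizes
  g x = side (run (config x))

  config-parts : ∀ (e : (i : Fin k) → Fin (extra i)) (z : Input k (size owners)) →
                 config (λ i → combine (e i) (z i)) ≡ (proj₁ (outer (e zero)) , read owners z , proj₂ (outer (e zero)))
  config-parts e z = cong₂ (λ o as → proj₁ o , as , proj₂ o)
    (cong (outer ∘ proj₁) (remQuot-combine (e zero) (z zero)))
    (read-cong owners (λ i → cong proj₂ (remQuot-combine (e i) (z i))))

  config-cong : ∀ {x y : Input k sizes} → (∀ i → x i ≡ y i) → config x ≡ config y
  config-cong x≗y = cong₂ (λ o as → proj₁ o , as , proj₂ o)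
    (cong (outer ∘ extraOf zero) (x≗y zero)) (read-cong owners (λ i → cong (shareOf i) (x≗y i)))

  config-injective : ∀ (x y : Input k sizes) → config x ≡ config y → ∀ i → x i ≡ y i
  config-injective x y eq i =
    remQuot-injective (size owners i) (cong₂ _,_ (extras i) (read-injective owners _ _ (,-injectiveˡ (,-injectiveʳ eq)) i))
    where
    extras : ∀ i → extraOf i (x i) ≡ extraOf i (y i)
    extras zero    = remQuot-injective (W !) (cong₂ _,_ (,-injectiveˡ eq) (,-injectiveʳ (,-injectiveʳ eq)))
    extras (suc i) with extraOf (suc i) (x (suc i)) | extraOf (suc i) (y (suc i))
    ... | zero | zero = refl

  onExtra : (Fin W → Fin W) → (Code → Code) → ∀ i → Fin (extra i) → Fin (extra i)
  onExtra fu fc zero    e = combine (fu (proj₁ (outer e))) (fc (proj₂ (outer e)))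
  onExtra fu fc (suc _) e = e

  localMap : (Fin W → Fin W) → (Code → Code) → (∀ i → Fin (size owners i) → Fin (size owners i)) →
             ∀ i → Fin (sizes i) → Fin (sizes i)
  localMap fu fc h i z = combine (onExtra fu fc i (extraOf i z)) (h i (shareOf i z))

  config-localMap : ∀ fu fc h (x : Input k sizes) →
    config (λ i → localMap fu fc h i (x i)) ≡ (fu (proj₁ (config x)) , read owners (λ i → h i (shareOf i (x i))) , fc (proj₂ (proj₂ (config x))))
  config-localMap fu fc h x = trans (config-parts _ _)
    (cong (λ o → proj₁ o , read owners (λ i → h i (shareOf i (x i))) , proj₂ o) (remQuot-combine {W} _ _))

  localMap-injective : ∀ {fu fc h} → Injective _≡_ _≡_ fu → Injective _≡_ _≡_ fc → (∀ i → Injective _≡_ _≡_ (h i)) →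
                       ∀ i → Injective _≡_ _≡_ (localMap fu fc h i)
  localMap-injective {fu} {fc} {h} fu-inj fc-inj h-inj i {z} {z′} eq =
    remQuot-injective (size owners i) (cong₂ _,_ (onExtra-injective i (proj₁ parts)) (h-inj i (proj₂ parts)))
    where
    parts = combine-injective {m = extra i} _ _ _ _ eq
    onExtra-injective : ∀ i {e e′} → onExtra fu fc i e ≡ onExtra fu fc i e′ → e ≡ e′
    onExtra-injective zero    eq′ = remQuot-injective (W !)
      (cong₂ _,_ (fu-inj (proj₁ (combine-injective {m = W} _ _ _ _ eq′))) (fc-inj (proj₂ (combine-injective {m = W} _ _ _ _ eq′))))
    onExtra-injective (suc _) eq′ = eq′

module Flip {k′ w ℓ : ℕ} (P : PBP (suc k′) w ℓ) where
  -- g is flippable: player 0 multiplies its final letter by the swap S, which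
  -- carries the run to the other side.

  open import Data.Nat using (ℕ; suc)
  open import Data.Bool using (not)
  open import Data.Fin using (Fin)
  open import Data.Product using (_,_; proj₁; proj₂)
  open import Function using (_∘_)
  open import Relation.Binary.PropositionalEquality
  open import Defs using (PBP; Flippable)

  open TheFunction P

  flipLocal : ∀ i → Fin (sizes i) → Fin (sizes i)
  flipLocal = localMap (λ u → u) (S ·_) (λ _ z → z)

  g-flip : ∀ x → not (g x) ≡ g (λ i → flipLocal i (x i))
  g-flip x = sym (begin
    g (λ i → flipLocal i (x i))                  ≡⟨ cong (side ∘ run) (config-localMap (λ u → u) (S ·_) (λ _ z → z) x) ⟩
    side (run (u , as , S · c))                  ≡⟨ cong side (run-· u as S c) ⟩
    side (app S (run (u , as , c)))              ≡⟨ side-S _ ⟩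
    not (g x)                                    ∎)
    where
    open ≡-Reasoning
    u = proj₁ (config x)
    as = proj₁ (proj₂ (config x))
    c = proj₂ (proj₂ (config x))

  flippable : Flippable g
  flippable = flipLocal , localMap-injective (λ eq → eq) (·-injectiveʳ S) (λ _ eq → eq) , g-flip

module Randomize {k′ w ℓ : ℕ} (P : PBP (suc k′) w ℓ) where
  -- The shared randomness is a shift
  -- (r₀ , r₁ … r_ℓ , E κ) of the configuration whose outer letter preserves
  -- sides.  Each player applies it to his own part: player 0 moves u and c,
  -- every player conjugates the letters at his positions.  The configuration
  -- is shifted, so the value of g is kept; since these shifts form a group
  -- acting freely and transitively on the configurations of each side, the
  -- image of a z-input is uniform over the z-inputs.

  open import Data.Nat using (ℕ; suc)
  open import Data.Fin using (Fin)
  open import Data.Vec using (Vec; []; _∷_; zipWith; map; _⊛_)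
  open import Data.Product using (Σ; _×_; _,_; proj₁; proj₂)
  open import Function using (_∘_)
  open import Relation.Binary.PropositionalEquality
  open import Defs using (PBP; Input; hits; RandomSelfReducible)
  open Counting

  open TheFunction P

  Rnd : Set
  Rnd = Code × Vec Code ℓ × K.Code

  lift : Rnd → Shift ℓ
  lift (r₀ , rs , κ) = r₀ , rs , E κ

  conjugators : ∀ {m} → Code → Vec Code m → Vec (Code → Code) m
  conjugators p []       = []
  conjugators p (r ∷ rs) = (λ a → r · a · p ⁻¹) ∷ conjugators r rs

  conjugators-⊛ : ∀ {m} p (rs as : Vec Code m) → (conjugators p rs ⊛ as) ≡ conjugateWord p rs as
  conjugators-⊛ p []       []       = refl
  conjugators-⊛ p (r ∷ rs) (a ∷ as) = cong (r · a · p ⁻¹ ∷_) (conjugators-⊛ r rs as)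

  randomizeLocal : ∀ i → Fin (sizes i) → Rnd → Fin (sizes i)
  randomizeLocal i z (r₀ , rs , κ) =
    localMap (app r₀) (λ c → E κ · c · lastOf r₀ rs ⁻¹) (λ i → transform owners i (conjugators r₀ rs)) i z

  config-randomize : ∀ (x : Input k sizes) ρ → config (λ i → randomizeLocal i (x i) ρ) ≡ shift (lift ρ) (config x)
  config-randomize x (r₀ , rs , κ) = trans
    (config-localMap (app r₀) (λ c → E κ · c · lastOf r₀ rs ⁻¹) (λ i → transform owners i (conjugators r₀ rs)) x)
    (cong (λ as → app r₀ (proj₁ (config x)) , as , E κ · proj₂ (proj₂ (config x)) · lastOf r₀ rs ⁻¹)
          (trans (read-transform owners (conjugators r₀ rs) _) (conjugators-⊛ r₀ rs _)))

  g-randomize : ∀ (x : Input k sizes) ρ → g (λ i → randomizeLocal i (x i) ρ) ≡ g x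
  g-randomize x ρ@(r₀ , rs , κ) = begin
    side (run (config (λ i → randomizeLocal i (x i) ρ)))  ≡⟨ cong (side ∘ run) (config-randomize x ρ) ⟩
    side (run (shift (lift ρ) (config x)))               ≡⟨ cong side (run-shift r₀ rs (E κ) (config x)) ⟩
    side (app (E κ) (run (config x)))                    ≡⟨ side-E κ _ ⟩
    side (run (config x))                                ∎
    where open ≡-Reasoning

  infixr 7 _∙_
  _∙_ : Rnd → Rnd → Rnd
  (h₀ , hs , η) ∙ (r₀ , rs , κ) = h₀ · r₀ , zipWith _·_ hs rs , η K.· κ

  inverse : Rnd → Rnd
  inverse (h₀ , hs , η) = h₀ ⁻¹ , map _⁻¹ hs , η K.⁻¹

  word-cancel : ∀ {m} (hs rs : Vec Code m) → zipWith _·_ hs (zipWith _·_ (map _⁻¹ hs) rs) ≡ rs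
  word-cancel []       []       = refl
  word-cancel (h ∷ hs) (r ∷ rs) = cong₂ _∷_ (cancelˡ h r) (word-cancel hs rs)

  word-cancel′ : ∀ {m} (hs rs : Vec Code m) → zipWith _·_ (map _⁻¹ hs) (zipWith _·_ hs rs) ≡ rs
  word-cancel′ []       []       = refl
  word-cancel′ (h ∷ hs) (r ∷ rs) = cong₂ _∷_ (cancelˡ′ h r) (word-cancel′ hs rs)

  ∙-cancel : ∀ h r → h ∙ inverse h ∙ r ≡ r
  ∙-cancel (h₀ , hs , η) (r₀ , rs , κ) = cong₂ _,_ (cancelˡ h₀ r₀) (cong₂ _,_ (word-cancel hs rs) (K.cancelˡ η κ))

  ∙-cancel′ : ∀ h r → inverse h ∙ h ∙ r ≡ r
  ∙-cancel′ (h₀ , hs , η) (r₀ , rs , κ) = cong₂ _,_ (cancelˡ′ h₀ r₀) (cong₂ _,_ (word-cancel′ hs rs) (K.cancelˡ′ η κ))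

  shift-∙ : ∀ h r c → shift (lift (h ∙ r)) c ≡ shift (lift h) (shift (lift r) c)
  shift-∙ h@(h₀ , hs , η) r@(r₀ , rs , κ) c =
    trans (cong (λ e → shift (h₀ · r₀ , zipWith _·_ hs rs , e) c) (E-hom η κ)) (shift-⊗ (lift h) (lift r) c)

  lift-transitive : ∀ (c c′ : Config ℓ) → side (run c) ≡ side (run c′) → Σ Rnd λ h → shift (lift h) c ≡ c′
  lift-transitive c c′ same-side with E-transitive (run c) (run c′) same-side
  ... | κ , moves with shift-transitive c c′ (E κ) moves
  ...   | (r₀ , rs) , shifted = (r₀ , rs , κ) , shifted

  hit→shift : ∀ (x y : Input k sizes) r → (∀ i → randomizeLocal i (x i) r ≡ y i) → shift (lift r) (config x) ≡ config y
  hit→shift x y r hit = trans (sym (config-randomize x r)) (config-cong hit)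

  shift→hit : ∀ (x y : Input k sizes) r → shift (lift r) (config x) ≡ config y → ∀ i → randomizeLocal i (x i) r ≡ y i
  shift→hit x y r shifted = config-injective _ _ (trans (config-randomize x r) shifted)

  rndCoding : Coding Rnd
  rndCoding = ×-coding (finCoding one) (×-coding (vecCoding (finCoding one) ℓ) (finCoding K.one))

  -- The image of a z-input x is a z-input; for z-inputs y and y′ = h y the
  -- bijection r ↦ h ∙ r of Rnd matches the codes hitting y with those hitting y′.
  randomSelfReducible : RandomSelfReducible g
  randomSelfReducible = Coding.bound rndCoding , coded rndCoding randomizeLocal , λ z x gx≡z →
    (λ r → trans (g-randomize x (Coding.uncode rndCoding r)) gx≡z) ,
    λ y y′ gy≡z gy′≡z → uniform x y y′ (lift-transitive (config y) (config y′) (trans gy≡z (sym gy′≡z)))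
    where
    uniform : ∀ x y y′ → Σ Rnd (λ h → shift (lift h) (config y) ≡ config y′) →
              hits (coded rndCoding randomizeLocal) x y ≡ hits (coded rndCoding randomizeLocal) x y′
    uniform x y y′ (h , y↦y′) = hits-transfer rndCoding randomizeLocal (h ∙_) (inverse h ∙_) (∙-cancel h) (∙-cancel′ h) x y y′
      (λ r hit′ → shift→hit x y r (shift-injective (lift h) (begin
        shift (lift h) (shift (lift r) (config x))  ≡⟨ shift-∙ h r (config x) ⟨
        shift (lift (h ∙ r)) (config x)            ≡⟨ hit→shift x y′ (h ∙ r) hit′ ⟩
        config y′                                  ≡⟨ y↦y′ ⟨
        shift (lift h) (config y)                  ∎)))
      (λ r hit → shift→hit x y′ (h ∙ r) (begin
        shift (lift (h ∙ r)) (config x)            ≡⟨ shift-∙ h r (config x) ⟩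
        shift (lift h) (shift (lift r) (config x))  ≡⟨ cong (shift (lift h)) (hit→shift x y r hit) ⟩
        shift (lift h) (config y)                  ≡⟨ y↦y′ ⟩
        config y′                                  ∎))
      where open ≡-Reasoning

module AndReduction {k′ w ℓ : ℕ} (P : PBP (suc k′) w ℓ) where
  -- Player i with bit b writes, at each of his positions, the
  -- letter E π or E τ of the instruction (the permutation selected by b,
  -- acting on both copies); player 0 also holds the start point inl j and the
  -- final letter X j, where j is a point moved by γ.  The run is then
  -- X j (inl (P(y) j)): on a 1-input P(y) = γ and inl (γ j) stays on the left,
  -- on a 0-input P(y) = e and X j carries inl j to the right.

  open import Data.Nat using (ℕ; suc)
  open import Data.Bool using (Bool; true; false)
  open import Data.Fin using (Fin; zero; suc; combine)
  open import Data.Fin.Properties using (remQuot-combine; combine-injective; ↑ˡ-injective)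
  open import Data.Fin.Permutation using (_⟨$⟩ʳ_)
  open import Data.Vec using ([]; _∷_; lookup; tabulate)
  open import Data.Vec.Properties using (lookup-map; tabulate-cong)
  open import Data.Product using (_×_; _,_; proj₁; proj₂)
  open import Data.Empty using (⊥-elim)
  open import Function using (_∘_)
  open import Function.Definitions using (Injective)
  open import Relation.Binary.PropositionalEquality
  open import Defs using (PBP; Perm; instr; evalPBP; _≈ₚ_; AND; Computes; ANDReduces)
  open SymCode
  open Sensitivity

  open TheFunction P

  letterFor : Fin k × Perm w × Perm w → Bool → Code
  letterFor ins b = E (encode (instr (λ _ → b) ins))

  instr-local : ∀ (y : Fin k → Bool) (ins : Fin k × Perm w × Perm w) → instr (λ _ → y (proj₁ ins)) ins ≡ instr y ins
  instr-local y (o , π , τ) with y o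
  ... | true  = refl
  ... | false = refl

  E-encode-injective : ∀ (π τ : Perm w) → E (encode π) ≡ E (encode τ) → π ≈ₚ τ
  E-encode-injective π τ eq t = ↑ˡ-injective w _ _ (begin
    inl (π ⟨$⟩ʳ t)                  ≡⟨ cong inl (K.app-encode π t) ⟨
    inl (K.app (encode π) t)        ≡⟨ E-inl (encode π) t ⟨
    app (E (encode π)) (inl t)      ≡⟨ cong (λ a → app a (inl t)) eq ⟩
    app (E (encode τ)) (inl t)      ≡⟨ E-inl (encode τ) t ⟩
    inl (K.app (encode τ) t)        ≡⟨ cong inl (K.app-encode τ t) ⟩
    inl (τ ⟨$⟩ʳ t)                  ∎)
    where open ≡-Reasoning

  run-program : ∀ {m} (Q : PBP k w m) (y : Fin k → Bool) (t : Fin w) (c : Code) →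
                run (inl t , tabulate (λ l → E (encode (instr y (lookup Q l)))) , c) ≡ app c (inl (evalPBP Q y ⟨$⟩ʳ t))
  run-program []        y t c = refl
  run-program (ins ∷ Q) y t c = trans
    (cong (λ v → run (v , tabulate (λ l → E (encode (instr y (lookup Q l)))) , c))
          (trans (E-inl _ t) (cong inl (K.app-encode (instr y ins) t))))
    (run-program Q y (instr y ins ⟨$⟩ʳ t) c)

  module _ (j : Fin w) where

    startExtra : ∀ i → Fin (extra i)
    startExtra zero    = combine (inl j) (X j)
    startExtra (suc _) = zero

    ρ : ∀ i → Bool → Fin (sizes i)
    ρ i b = combine (startExtra i) (write owners i (λ l → letterFor (lookup P l) b))

    read-ρ : ∀ (y : Fin k → Bool) → read owners (λ i → write owners i (λ l → letterFor (lookup P l) (y i)))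
                                    ≡ tabulate (λ l → E (encode (instr y (lookup P l))))
    read-ρ y = trans (read-write owners _) (tabulate-cong λ l → begin
      letterFor (lookup P l) (y (lookup owners l))         ≡⟨ cong (letterFor (lookup P l) ∘ y) (lookup-map l proj₁ P) ⟩
      letterFor (lookup P l) (y (proj₁ (lookup P l)))      ≡⟨ cong (E ∘ encode) (instr-local y (lookup P l)) ⟩
      E (encode (instr y (lookup P l)))                    ∎)
      where open ≡-Reasoning

    g-ρ : ∀ (y : Fin k → Bool) → g (λ i → ρ i (y i)) ≡ side (app (X j) (inl (evalPBP P y ⟨$⟩ʳ j)))
    g-ρ y = cong side (trans
      (cong run (trans (config-parts startExtra _)
         (cong₂ (λ o as → proj₁ o , as , proj₂ o) (remQuot-combine (inl j) (X j)) (read-ρ y))))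
      (run-program P y j (X j)))

    module _ (computes : Computes P (AND k)) (j-moved : proj₁ computes ⟨$⟩ʳ j ≢ j) where

      open Requirements P computes

      AND-via-g : ∀ y → AND k y ≡ g (λ i → ρ i (y i))
      AND-via-g y with AND k y in eq
      ... | true  = sym (begin
        g (λ i → ρ i (y i))                               ≡⟨ g-ρ y ⟩
        side (app (X j) (inl (evalPBP P y ⟨$⟩ʳ j)))        ≡⟨ cong (λ t → side (app (X j) (inl t))) (proj₂ (proj₂ (proj₂ computes) y) eq j) ⟩
        side (app (X j) (inl (γ ⟨$⟩ʳ j)))                  ≡⟨ side-X-elsewhere j _ j-moved ⟩
        true                                              ∎)
        where open ≡-Reasoning
      ... | false = sym (begin
        g (λ i → ρ i (y i))                               ≡⟨ g-ρ y ⟩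
        side (app (X j) (inl (evalPBP P y ⟨$⟩ʳ j)))        ≡⟨ cong (λ t → side (app (X j) (inl t))) (proj₁ (proj₂ (proj₂ computes) y) eq j) ⟩
        side (app (X j) (inl j))                          ≡⟨ side-X-here j ⟩
        false                                             ∎)
        where open ≡-Reasoning

      -- A harmful instruction on variable i lets player i's share tell his bit.
      bits-distinguished : ∀ i → ρ i false ≢ ρ i true
      bits-distinguished i eq with sensitive i
      ... | l , reads-i , harmful = harmful (E-encode-injective _ _
        (write-injective owners i _ _ (proj₂ (combine-injective {m = extra i} _ _ _ _ eq)) l (trans (lookup-map l proj₁ P) reads-i)))

      ρ-injective : ∀ i → Injective _≡_ _≡_ (ρ i)
      ρ-injective i {false} {false} _  = refl
      ρ-injective i {true}  {true}  _  = refl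
      ρ-injective i {false} {true}  eq = ⊥-elim (bits-distinguished i eq)
      ρ-injective i {true}  {false} eq = ⊥-elim (bits-distinguished i (sym eq))

      andReduces : ANDReduces g
      andReduces = ρ , ρ-injective , AND-via-g

module Bits where
  -- With lw = ⌈log₂ w⌉ and L = (lw + 1) W we have
  -- W ≤ 2^(lw+1) and W! ≤ W^W ≤ 2^L, so a slot costs at most L bits and player
  -- 0's extra part at most (lw + 1) + L bits.  Every position is owned by one
  -- player, hence the shares need at most ℓ L bits altogether, and the total is
  -- at most (lw + 1) + L + ℓ L ≤ 12 ℓ w lw once ℓ ≥ 1 and w ≥ 2.

  open import Data.Nat using (ℕ; zero; suc; _+_; _*_; _!; _^_; _≤_; _<_; z≤n; s≤s; ⌈_/2⌉)
  open import Data.Nat.Properties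
  open import Data.Nat.Logarithm using (⌈log₂_⌉; ⌈log₂⌉-mono-≤; ⌈log₂2^n⌉≡n)
  open import Data.Nat.Logarithm.Core using (⌈log2⌉)
  open import Data.Nat.Solver using (module +-*-Solver)
  open import Induction.WellFounded using (Acc; acc)
  open import Data.Fin using (Fin; zero; suc)
  open import Data.Vec using (Vec; []; _∷_; tabulate; sum)
  open import Relation.Binary.PropositionalEquality
  open import Defs using (PBP; inputBits)

  -- n ≤ 2^⌈log₂ n⌉, by the recursion ⌈log₂ (n + 2)⌉ = 1 + ⌈log₂ (1 + ⌈n/2⌉)⌉ defining it.
  n≤2^⌈log2⌉ : ∀ n (rec : Acc _<_ n) → n ≤ 2 ^ ⌈log2⌉ n rec
  n≤2^⌈log2⌉ zero          _         = z≤n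
  n≤2^⌈log2⌉ (suc zero)    _         = s≤s z≤n
  n≤2^⌈log2⌉ (suc (suc n)) (acc rec) = begin
    suc (suc n)                    ≤⟨ s≤s (s≤s n≤2⌈n/2⌉) ⟩
    suc (suc (⌈ n /2⌉ + ⌈ n /2⌉))  ≡⟨ cong suc (+-suc ⌈ n /2⌉ ⌈ n /2⌉) ⟨
    suc ⌈ n /2⌉ + suc ⌈ n /2⌉      ≤⟨ +-mono-≤ half (≤-trans half (≤-reflexive (sym (+-identityʳ _)))) ⟩
    2 ^ ⌈log2⌉ (suc (suc n)) (acc rec) ∎
    where
    open ≤-Reasoning
    half = n≤2^⌈log2⌉ (suc ⌈ n /2⌉) (rec _)
    n≤2⌈n/2⌉ : n ≤ ⌈ n /2⌉ + ⌈ n /2⌉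
    n≤2⌈n/2⌉ = ≤-trans (≤-reflexive (sym (⌊n/2⌋+⌈n/2⌉≡n n))) (+-monoˡ-≤ ⌈ n /2⌉ (⌊n/2⌋≤⌈n/2⌉ n))

  n≤2^⌈log₂n⌉ : ∀ n → n ≤ 2 ^ ⌈log₂ n ⌉
  n≤2^⌈log₂n⌉ n = n≤2^⌈log2⌉ n _

  positive-if-log-positive : ∀ n → 1 ≤ ⌈log₂ n ⌉ → 1 ≤ n
  positive-if-log-positive (suc n) _ = s≤s z≤n

  ⌈log₂⌉-positive : ∀ {n} → 2 ≤ n → 1 ≤ ⌈log₂ n ⌉
  ⌈log₂⌉-positive 2≤n = ≤-trans (≤-reflexive (sym (⌈log₂2^n⌉≡n 1))) (⌈log₂⌉-mono-≤ 2≤n)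

  ⌈log₂⌉-≤ : ∀ {n b} → n ≤ 2 ^ b → ⌈log₂ n ⌉ ≤ b
  ⌈log₂⌉-≤ {n} {b} n≤2^b = ≤-trans (⌈log₂⌉-mono-≤ n≤2^b) (≤-reflexive (⌈log₂2^n⌉≡n b))

  *-≤-2^ : ∀ {a b x y} → a ≤ 2 ^ x → b ≤ 2 ^ y → a * b ≤ 2 ^ (x + y)
  *-≤-2^ {x = x} {y} a≤ b≤ = ≤-trans (*-mono-≤ a≤ b≤) (≤-reflexive (sym (^-distribˡ-+-* 2 x y)))

  n!≤n^n : ∀ n → n ! ≤ n ^ n
  n!≤n^n zero    = s≤s z≤n
  n!≤n^n (suc n) = *-monoʳ-≤ (suc n) (≤-trans (n!≤n^n n) (^-monoˡ-≤ n (n≤1+n n)))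

  total : ∀ {k} → (Fin k → ℕ) → ℕ
  total f = sum (tabulate f)

  total-zero : ∀ k → total {k} (λ _ → 0) ≡ 0
  total-zero zero    = refl
  total-zero (suc k) = total-zero k

  total-+ : ∀ {k} (f g : Fin k → ℕ) → total (λ i → f i + g i) ≡ total f + total g
  total-+ {zero}  f g = refl
  total-+ {suc k} f g = trans (cong (f zero + g zero +_) (total-+ (λ i → f (suc i)) (λ i → g (suc i))))
                              (solve 4 (λ a b c d → (a :+ b) :+ (c :+ d) := (a :+ c) :+ (b :+ d)) refl (f zero) (g zero) _ _)
    where open +-*-Solver

  total-mono : ∀ {k} {f g : Fin k → ℕ} → (∀ i → f i ≤ g i) → total f ≤ total g
  total-mono {zero}  f≤g = z≤n
  total-mono {suc k} f≤g = +-mono-≤ (f≤g zero) (total-mono (λ i → f≤g (suc i)))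

  -- If a letter fits in L bits, a slot costs L bits to its owner and none to
  -- the other players, so all shares together cost m L bits.
  module LayoutBits (M L : ℕ) (M≤2^L : M ≤ 2 ^ L) where

    open Layout M

    slotBits : ∀ {k} → Fin k → Fin k → ℕ
    slotBits zero    zero    = L
    slotBits zero    (suc _) = 0
    slotBits (suc _) zero    = 0
    slotBits (suc o) (suc i) = slotBits o i

    slot≤ : ∀ {k} (o i : Fin k) → slot o i ≤ 2 ^ slotBits o i
    slot≤ zero    zero    = M≤2^L
    slot≤ zero    (suc i) = s≤s z≤n
    slot≤ (suc o) zero    = s≤s z≤n
    slot≤ (suc o) (suc i) = slot≤ o i

    total-slotBits : ∀ {k} (o : Fin k) → total (slotBits o) ≡ L
    total-slotBits {suc k} zero    = trans (cong (L +_) (total-zero k)) (+-identityʳ L)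
    total-slotBits {suc k} (suc o) = total-slotBits o

    shareBits : ∀ {k m} → Vec (Fin k) m → Fin k → ℕ
    shareBits []       i = 0
    shareBits (o ∷ os) i = slotBits o i + shareBits os i

    size≤ : ∀ {k m} (os : Vec (Fin k) m) i → size os i ≤ 2 ^ shareBits os i
    size≤ []       i = s≤s z≤n
    size≤ (o ∷ os) i = *-≤-2^ {x = slotBits o i} {y = shareBits os i} (slot≤ o i) (size≤ os i)

    total-shareBits : ∀ {k m} (os : Vec (Fin k) m) → total (shareBits os) ≡ m * L
    total-shareBits {k} []       = total-zero k
    total-shareBits     (o ∷ os) = trans (total-+ (slotBits o) (shareBits os)) (cong₂ _+_ (total-slotBits o) (total-shareBits os))

  module ProgramBits {k′ w ℓ : ℕ} (P : PBP (suc k′) w ℓ) where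

    open TheFunction P

    -- lw = ⌈log₂ w⌉ bits address a point of one copy, LW = lw + 1 a point of
    -- Fin W, and L = LW W bits a letter.
    lw LW L : ℕ
    lw = ⌈log₂ w ⌉
    LW = suc lw
    L  = LW * W

    W≤2^LW : W ≤ 2 ^ LW
    W≤2^LW = +-mono-≤ (n≤2^⌈log₂n⌉ w) (≤-trans (n≤2^⌈log₂n⌉ w) (≤-reflexive (sym (+-identityʳ _))))

    W!≤2^L : W ! ≤ 2 ^ L
    W!≤2^L = ≤-trans (n!≤n^n W) (≤-trans (^-monoˡ-≤ W W≤2^LW) (≤-reflexive (^-*-assoc 2 LW W)))

    open LayoutBits (W !) L W!≤2^L

    extraBits : Fin k → ℕ
    extraBits zero    = LW + L
    extraBits (suc _) = 0

    extra≤ : ∀ i → extra i ≤ 2 ^ extraBits i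
    extra≤ zero    = *-≤-2^ {x = LW} {y = L} W≤2^LW W!≤2^L
    extra≤ (suc i) = s≤s z≤n

    inputBits≤ : inputBits k sizes ≤ (LW + L) + ℓ * L
    inputBits≤ = begin
      total {k} (λ i → ⌈log₂ sizes i ⌉)                ≤⟨ total-mono {g = λ i → extraBits i + shareBits owners i} (λ i → ⌈log₂⌉-≤ (*-≤-2^ {x = extraBits i} {y = shareBits owners i} (extra≤ i) (size≤ owners i))) ⟩
      total (λ i → extraBits i + shareBits owners i)   ≡⟨ total-+ extraBits (shareBits owners) ⟩
      (LW + L + total {k′} (λ _ → 0)) + total (shareBits owners) ≡⟨ cong₂ _+_ (trans (cong (LW + L +_) (total-zero k′)) (+-identityʳ _)) (total-shareBits owners) ⟩
      (LW + L) + ℓ * L                             ∎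
      where open ≤-Reasoning

    -- With ℓ ≥ 1 and lw ≥ 1: LW ≤ L ≤ ℓ L and L ≤ 4 w lw.
    inputBits-bound : 1 ≤ ℓ → 1 ≤ lw → inputBits k sizes ≤ 12 * (ℓ * (w * lw))
    inputBits-bound 1≤ℓ 1≤lw = begin
      inputBits k sizes             ≤⟨ inputBits≤ ⟩
      (LW + L) + ℓ * L              ≤⟨ +-monoˡ-≤ (ℓ * L) (+-mono-≤ (≤-trans LW≤L L≤ℓL) L≤ℓL) ⟩
      (ℓ * L + ℓ * L) + ℓ * L       ≡⟨ solve 2 (λ a b → (a :* b :+ a :* b) :+ a :* b := con 3 :* (a :* b)) refl ℓ L ⟩
      3 * (ℓ * L)                   ≤⟨ *-monoʳ-≤ 3 (*-monoʳ-≤ ℓ L≤4wlw) ⟩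
      3 * (ℓ * (4 * (w * lw)))      ≡⟨ solve 3 (λ a b c → con 3 :* (a :* (con 4 :* (b :* c))) := con 12 :* (a :* (b :* c))) refl ℓ w lw ⟩
      12 * (ℓ * (w * lw))           ∎
      where
      open ≤-Reasoning
      open +-*-Solver
      1≤w : 1 ≤ w
      1≤w = positive-if-log-positive w 1≤lw
      LW≤L : LW ≤ L
      LW≤L = ≤-trans (≤-reflexive (sym (*-identityʳ LW))) (*-monoʳ-≤ LW (≤-trans 1≤w (m≤m+n w w)))
      L≤ℓL : L ≤ ℓ * L
      L≤ℓL = ≤-trans (≤-reflexive (sym (*-identityˡ L))) (*-monoˡ-≤ L 1≤ℓ)
      L≤4wlw : L ≤ 4 * (w * lw)
      L≤4wlw = ≤-trans (*-monoˡ-≤ W (+-monoˡ-≤ lw 1≤lw)) (≤-reflexive (solve 2 (λ a b → (b :+ b) :* (a :+ a) := con 4 :* (a :* b)) refl w lw))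

open Sensitivity using (module Requirements; empty-program; program-nonempty; two-points)
open Bits using (module ProgramBits; ⌈log₂⌉-positive)

-- With no players the
-- program is empty and computes nothing; otherwise g, with the point j moved
-- by γ, has all three properties and its size is bounded as counted in Bits.
versatile-from-AND : ∀ (k w ℓ : ℕ) (P : PBP k w ℓ) → Computes P (AND k) →
  Σ (Fin k → ℕ) λ s → Σ (KParty k s) λ g → Versatile g × inputBits k s ≤ 12 * (ℓ * (w * ⌈log₂ w ⌉))
versatile-from-AND zero     w ℓ []             computes = ⊥-elim (empty-program computes)
versatile-from-AND zero     w ℓ ((() , _) ∷ _) computes
versatile-from-AND (suc k′) w ℓ P              computes =
  sizes , g ,
  (AndReduction.andReduces P j computes j-moved , Flip.flippable P , Randomize.randomSelfReducible P) ,
  ProgramBits.inputBits-bound P (program-nonempty P computes) (⌈log₂⌉-positive (two-points _ _ j-moved))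
  where
  open TheFunction P using (sizes; g)
  open Requirements P computes using (moved)
  j = proj₁ moved
  j-moved = proj₂ moved

lemma4 : ∃[ C ] ∀ (k w ℓ : ℕ) (P : PBP k w ℓ) → Computes P (AND k) →
    Σ (Fin k → ℕ) λ s → Σ (KParty k s) λ g →
      Versatile g × inputBits k s ≤ C * (ℓ * (w * ⌈log₂ w ⌉))
lemma4 = 12 , versatile-from-AND
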